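{- Fix positive integers $a,n$ and write \[\left(1+y+y^2+\cdots+y^{a-1}\right)^n=\sum_{k=0}^{n(a-1)}c_k\,y^k.\] If $0\le i\le a-1$ and $f$ is a polynomial of degree less than $n$, then the polynomial \[\Sigma_i f(y):=\sum_{k\equiv i\ (\mathrm{mod}\ a)}c_k\,f(y-k)\] is independent of $i$, and hence \[\Sigma_i f(y)=\frac1a\,\left(1+S+S^2+\cdots+S^{a-1}\right)^n f,\] where $S$ is the shift operator $(Sf)(y)=f(y-1)$. -}

module Defs where

open import Data.Nat as ℕ using (ℕ; zero; suc; NonZero; _%_; _≡ᵇ_)
open import Data.List using (List; []; _∷_; replicate; map; upTo; sum; foldr)
open import Data.Vec using (Vec; []; _∷_)
open import Data.Bool using (if_then_else_)
open import Data.Integer using (+_)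
open import Data.Rational using (ℚ; 0ℚ; 1ℚ; _+_; _*_; _-_; _/_)

toℚ : ℕ → ℚ
toℚ k = (+ k) / 1

-- Polynomials with natural coefficients as coefficient lists [c₀, c₁, …]

addL : List ℕ → List ℕ → List ℕ
addL [] q = q
addL (x ∷ p) [] = x ∷ p
addL (x ∷ p) (y ∷ q) = (x ℕ.+ y) ∷ addL p q

mulL : List ℕ → List ℕ → List ℕ
mulL [] q = []
mulL (x ∷ p) q = addL (map (x ℕ.*_) q) (0 ∷ mulL p q)

powL : List ℕ → ℕ → List ℕ
powL p zero = 1 ∷ []
powL p (suc n) = mulL p (powL p n)

coeffL : List ℕ → ℕ → ℕ
coeffL [] k = 0
coeffL (x ∷ p) zero = x
coeffL (x ∷ p) (suc k) = coeffL p k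

c : ℕ → ℕ → ℕ → ℕ
c a n k = coeffL (powL (replicate a 1) n) k

-- Polynomials over ℚ of degree < n : coefficient vectors (f₀, …, f_{n-1}),
-- evaluated as f(y) = Σ_j f_j y^j (Horner).

eval : ∀ {n} → Vec ℚ n → ℚ → ℚ
eval [] y = 0ℚ
eval (x ∷ f) y = x + y * eval f y

Σᵢ : (a n : ℕ) → .{{NonZero a}} → ℕ → (ℚ → ℚ) → ℚ → ℚ
Σᵢ a n i f y =
  sum' (map (λ k → if (k % a) ≡ᵇ i then toℚ (c a n k) * f (y - toℚ k) else 0ℚ)
            (upTo (suc (n ℕ.* (a ℕ.∸ 1)))))
  where
  sum' : List ℚ → ℚ
  sum' = foldr _+_ 0ℚ

S : (ℚ → ℚ) → ℚ → ℚ
S f y = f (y - 1ℚ)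

Sʲ : ℕ → (ℚ → ℚ) → ℚ → ℚ
Sʲ zero f = f
Sʲ (suc j) f = S (Sʲ j f)

geomS : ℕ → (ℚ → ℚ) → ℚ → ℚ
geomS a f y = foldr _+_ 0ℚ (map (λ j → Sʲ j f y) (upTo a))

geomSⁿ : ℕ → ℕ → (ℚ → ℚ) → ℚ → ℚ
geomSⁿ a zero f = f
geomSⁿ a (suc n) f = geomS a (geomSⁿ a n f)

-- Write shiftPoly p w for the operator Σₖ wₖ pₖ Sᵏ, and call a weight sequence w
-- window-normalised when any a consecutive weights sum to 1; the indicator of a
-- residue class mod a and the constant sequence 1/a are both window-normalised.
-- The coefficients of (1 + y + ⋯ + y^(a-1))^(n+1) are the sum of a shifted copies of
-- those for n, and Sᵐ f = f − Σ_{t<m} Sᵗ Δf with Δ = 1 − S.  Hence, for exponent n+1,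
-- the operator with a window-normalised weight w applied to f equals the exponent-n
-- operator with weight 1 applied to f, minus exponent-n operators (with window-
-- normalised weights) applied to Sᵗ Δf.  As Δ lowers the degree, induction on n shows
-- that for deg f < n the value does not depend on the window-normalised weight;
-- comparing a residue-class weight with the constant weight 1/a gives both claims.
module Submission where

open import Defs
open import Algebra.Bundles using (CommutativeRing)
open import Data.Bool using (Bool; true; false; if_then_else_)
open import Data.Fin using (Fin; toℕ; inject₁; fromℕ)
open import Data.Fin.Properties using (toℕ<n; toℕ-inject₁; toℕ-fromℕ)
open import Data.Integer as ℤ using (+_)
import Data.Integer.Properties as ℤ
open import Data.List using (List; []; _∷_; length; replicate; map; upTo; applyUpTo; foldr)
open import Data.List.Properties using (map-upTo; map-cong; map-id; length-map; length-replicate)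
open import Data.Nat as ℕ using (ℕ; zero; suc; NonZero; _%_; _≡ᵇ_; _<_; s≤s)
import Data.Nat.Properties as ℕ
open import Data.Nat.Coprimality using (1-coprimeTo) renaming (sym to coprime-sym)
open import Data.Nat.DivMod using (m<n⇒m%n≡m; [m+n]%n≡m%n)
open import Data.Product using (_×_; _,_)
open import Data.Rational using (ℚ; mkℚ; 0ℚ; 1ℚ; _+_; _*_; _-_; _/_)
open import Data.Rational.Properties
  using (normalize-coprime; +-*-commutativeRing; +-0-group; +-comm; +-identityˡ; +-identityʳ;
         +-inverseʳ; *-identityˡ; *-identityʳ; *-zeroˡ; *-zeroʳ; *-inverseʳ)
open import Data.Rational.Solver using (module +-*-Solver)
open import Data.Vec using (Vec; []; _∷_)
open import Function using (_∘_)
open import Relation.Binary.PropositionalEquality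
  using (_≡_; refl; sym; trans; cong; cong₂; module ≡-Reasoning)

open import Algebra.Properties.Group +-0-group using (∙-cancelʳ)
open import Algebra.Properties.CommutativeSemigroup ℕ.+-commutativeSemigroup using (x∙yz≈y∙xz)
open import Algebra.Properties.Semiring.Sum (CommutativeRing.semiring +-*-commutativeRing)
  using (sum-syntax; sum-cong-≗; sum-replicate-zero; sum-init-last; ∑-distrib-+)
open +-*-Solver using (solve; _:+_; _:-_; _:*_; _:=_; con)
open ≡-Reasoning

toℚ≡mkℚ : ∀ k → toℚ k ≡ mkℚ (+ k) 0 (coprime-sym (1-coprimeTo k))
toℚ≡mkℚ k = normalize-coprime (coprime-sym (1-coprimeTo k))

toℚ-+ : ∀ m n → toℚ (m ℕ.+ n) ≡ toℚ m + toℚ n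
toℚ-+ m n = sym (trans (cong₂ _+_ (toℚ≡mkℚ m) (toℚ≡mkℚ n))
  (cong (_/ 1) (cong₂ ℤ._+_ (ℤ.*-identityʳ (+ m)) (ℤ.*-identityʳ (+ n)))))

toℚ-*-inverse : ∀ b → toℚ (suc b) * ((+ 1) / suc b) ≡ 1ℚ
toℚ-*-inverse b = trans (cong₂ _*_ (toℚ≡mkℚ (suc b)) (normalize-coprime (1-coprimeTo (suc b))))
  (*-inverseʳ (mkℚ (+ suc b) 0 (coprime-sym (1-coprimeTo (suc b)))))

sub-toℚ-suc : ∀ y k → y - toℚ (suc k) ≡ (y - toℚ k) - 1ℚ
sub-toℚ-suc y k = trans (cong (y -_) (toℚ-+ 1 k))
  (solve 2 (λ y t → y :- (con 1ℚ :+ t) := (y :- t) :- con 1ℚ) refl y (toℚ k))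

∑-const : ∀ n x → ∑[ m < n ] x ≡ toℚ n * x
∑-const zero    x = sym (*-zeroˡ x)
∑-const (suc n) x = begin
  x + ∑[ m < n ] x     ≡⟨ cong (λ t → x + t) (∑-const n x) ⟩
  x + toℚ n * x        ≡⟨ solve 2 (λ x t → x :+ t :* x := (con 1ℚ :+ t) :* x) refl x (toℚ n) ⟩
  (1ℚ + toℚ n) * x     ≡⟨ cong (_* x) (toℚ-+ 1 n) ⟨
  toℚ (suc n) * x      ∎

foldr-+-upTo : ∀ n (h : ℕ → ℚ) → foldr _+_ 0ℚ (map h (upTo n)) ≡ ∑[ k < n ] h (toℕ k)
foldr-+-upTo n h = trans (cong (foldr _+_ 0ℚ) (map-upTo h n)) (foldr-+-applyUpTo n h)
  where
  foldr-+-applyUpTo : ∀ n (h : ℕ → ℚ) → foldr _+_ 0ℚ (applyUpTo h n) ≡ ∑[ k < n ] h (toℕ k)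
  foldr-+-applyUpTo zero    h = refl
  foldr-+-applyUpTo (suc n) h = cong (λ t → h 0 + t) (foldr-+-applyUpTo n (h ∘ suc))

∑-periodic : ∀ {a} (h : ℕ → ℚ) → (∀ x → h (x ℕ.+ a) ≡ h x) →
             ∀ k → ∑[ m < a ] h (toℕ m ℕ.+ k) ≡ ∑[ m < a ] h (toℕ m)
∑-periodic {a} h periodic zero = sum-cong-≗ {a} (λ m → cong h (ℕ.+-identityʳ (toℕ m)))
∑-periodic {zero}  h periodic (suc k) = refl
∑-periodic {suc b} h periodic (suc k) = trans shift (∑-periodic h periodic k)
  where
  -- Sliding the window by one drops h k and adds h (k + a) = h k.
  shift : ∑[ m < suc b ] h (toℕ m ℕ.+ suc k) ≡ ∑[ m < suc b ] h (toℕ m ℕ.+ k)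
  shift = begin
    ∑[ m < suc b ] h (toℕ m ℕ.+ suc k)
      ≡⟨ sum-init-last {b} (λ m → h (toℕ m ℕ.+ suc k)) ⟩
    ∑[ m < b ] h (toℕ (inject₁ m) ℕ.+ suc k) + h (toℕ (fromℕ b) ℕ.+ suc k)
      ≡⟨ cong₂ _+_
           (sum-cong-≗ {b} (λ m → cong h (trans (cong (ℕ._+ suc k) (toℕ-inject₁ m)) (ℕ.+-suc (toℕ m) k))))
           (trans (cong h (trans (cong (ℕ._+ suc k) (toℕ-fromℕ b))
                                 (trans (ℕ.+-comm b (suc k)) (sym (ℕ.+-suc k b)))))
                  (periodic k)) ⟩
    ∑[ m < b ] h (suc (toℕ m) ℕ.+ k) + h k
      ≡⟨ +-comm _ (h k) ⟩
    ∑[ m < suc b ] h (toℕ m ℕ.+ k) ∎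

indicator : Bool → ℚ
indicator true  = 1ℚ
indicator false = 0ℚ

if-then-else-0 : ∀ b x → (if b then x else 0ℚ) ≡ indicator b * x
if-then-else-0 true  x = sym (*-identityˡ x)
if-then-else-0 false x = sym (*-zeroˡ x)

∑-indicator-≡ᵇ : ∀ {n} i → i < n → ∑[ m < n ] indicator (toℕ m ≡ᵇ i) ≡ 1ℚ
∑-indicator-≡ᵇ {zero}  i       ()
∑-indicator-≡ᵇ {suc n} zero    _         = cong (λ t → 1ℚ + t) (sum-replicate-zero n)
∑-indicator-≡ᵇ {suc n} (suc i) (s≤s i<n) = trans (+-identityˡ _) (∑-indicator-≡ᵇ i i<n)

Δ : (ℚ → ℚ) → ℚ → ℚ
Δ g y = g y - S g y

-- The polynomial notion "degree < n", phrased so that it makes sense for any function.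
ΔVanishes : ℕ → (ℚ → ℚ) → Set
ΔVanishes zero    g = ∀ y → g y ≡ 0ℚ
ΔVanishes (suc n) g = ΔVanishes n (Δ g)

ΔVanishes-cong : ∀ n {g h} → (∀ y → g y ≡ h y) → ΔVanishes n g → ΔVanishes n h
ΔVanishes-cong zero    g≗h vanish y = trans (sym (g≗h y)) (vanish y)
ΔVanishes-cong (suc n) g≗h vanish =
  ΔVanishes-cong n (λ y → cong₂ _-_ (g≗h y) (g≗h (y - 1ℚ))) vanish

ΔVanishes-S : ∀ n {g} → ΔVanishes n g → ΔVanishes n (S g)
ΔVanishes-S zero    vanish y = vanish (y - 1ℚ)
ΔVanishes-S (suc n) vanish   = ΔVanishes-S n vanish

ΔVanishes-Sʲ : ∀ n j {g} → ΔVanishes n g → ΔVanishes n (Sʲ j g)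
ΔVanishes-Sʲ n zero    vanish = vanish
ΔVanishes-Sʲ n (suc j) vanish = ΔVanishes-S n (ΔVanishes-Sʲ n j vanish)

ΔVanishes-+ : ∀ n {g h} → ΔVanishes n g → ΔVanishes n h → ΔVanishes n (λ y → g y + h y)
ΔVanishes-+ zero    vg vh y = cong₂ _+_ (vg y) (vh y)
ΔVanishes-+ (suc n) {g} {h} vg vh = ΔVanishes-cong n
  (λ y → solve 4 (λ a b c d → (a :- c) :+ (b :- d) := (a :+ b) :- (c :+ d)) refl
                 (g y) (h y) (g (y - 1ℚ)) (h (y - 1ℚ)))
  (ΔVanishes-+ n vg vh)

ΔVanishes-const : ∀ n x → ΔVanishes (suc n) (λ _ → x)
ΔVanishes-const zero    x y = +-inverseʳ x
ΔVanishes-const (suc n) x   = ΔVanishes-const n (x - x)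

-- Δ (y · h) = y · Δh + S h.
ΔVanishes-*id : ∀ n {h} → ΔVanishes n h → ΔVanishes (suc n) (λ y → y * h y)
ΔVanishes-*id zero    {h} vanish y =
  trans (cong₂ (λ u v → y * u - (y - 1ℚ) * v) (vanish y) (vanish (y - 1ℚ)))
        (solve 1 (λ y → y :* con 0ℚ :- (y :- con 1ℚ) :* con 0ℚ := con 0ℚ) refl y)
ΔVanishes-*id (suc n) {h} vanish = ΔVanishes-cong (suc n)
  (λ y → solve 3 (λ y u v → y :* (u :- v) :+ v := y :* u :- (y :- con 1ℚ) :* v) refl
                 y (h y) (h (y - 1ℚ)))
  (ΔVanishes-+ (suc n) {λ y → y * Δ h y} {S h} (ΔVanishes-*id n vanish) (ΔVanishes-S (suc n) {h} vanish))

eval-ΔVanishes : ∀ n (f : Vec ℚ n) → ΔVanishes n (eval f)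
eval-ΔVanishes zero    []      y = refl
eval-ΔVanishes (suc n) (x ∷ f) =
  ΔVanishes-+ (suc n) {λ _ → x} {λ y → y * eval f y}
    (ΔVanishes-const n x) (ΔVanishes-*id n (eval-ΔVanishes n f))

Sʲ-cong : ∀ j {g h} → (∀ z → g z ≡ h z) → ∀ y → Sʲ j g y ≡ Sʲ j h y
Sʲ-cong zero    g≗h y = g≗h y
Sʲ-cong (suc j) g≗h y = Sʲ-cong j g≗h (y - 1ℚ)

Sʲ-S : ∀ j g y → Sʲ j (S g) y ≡ Sʲ (suc j) g y
Sʲ-S zero    g y = refl
Sʲ-S (suc j) g y = Sʲ-S j g (y - 1ℚ)

Sʲ-telescope : ∀ m g z → g z ≡ Sʲ m g z + ∑[ t < m ] Sʲ (toℕ t) (Δ g) z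
Sʲ-telescope zero    g z = sym (+-identityʳ (g z))
Sʲ-telescope (suc m) g z = begin
  g z                                  ≡⟨ solve 3 (λ G A R → G := A :+ ((G :- (A :+ R)) :+ R)) refl (g z) A R ⟩
  A + ((g z - (A + R)) + R)            ≡⟨ cong (λ t → A + ((g z - t) + R)) (Sʲ-telescope m g (z - 1ℚ)) ⟨
  A + ((g z - g (z - 1ℚ)) + R)         ∎
  where
  A = Sʲ m g (z - 1ℚ)
  R = ∑[ t < m ] Sʲ (toℕ t) (Δ g) (z - 1ℚ)

-- shiftPoly p w g y = Σₖ w k · pₖ · g (y − k), i.e. the operator Σₖ wₖ pₖ Sᵏ applied to g.
shiftPoly : List ℕ → (ℕ → ℚ) → (ℚ → ℚ) → ℚ → ℚ
shiftPoly []      w g y = 0ℚ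
shiftPoly (x ∷ p) w g y = w 0 * (toℚ x * g y) + shiftPoly p (w ∘ suc) (S g) y

shiftPoly-∑ : ∀ p w g y →
  ∑[ k < length p ] (w (toℕ k) * (toℚ (coeffL p (toℕ k)) * g (y - toℚ (toℕ k)))) ≡ shiftPoly p w g y
shiftPoly-∑ []      w g y = refl
shiftPoly-∑ (x ∷ p) w g y = cong₂ _+_
  (cong (λ z → w 0 * (toℚ x * g z)) (+-identityʳ y))
  (trans (sum-cong-≗ {length p} (λ k → cong (λ z → w (suc (toℕ k)) * (toℚ (coeffL p (toℕ k)) * g z))
                                            (sub-toℚ-suc y (toℕ k))))
         (shiftPoly-∑ p (w ∘ suc) (S g) y))

shiftPoly-congᵍ : ∀ p w {g h} → (∀ z → g z ≡ h z) → ∀ y → shiftPoly p w g y ≡ shiftPoly p w h y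
shiftPoly-congᵍ []      w g≗h y = refl
shiftPoly-congᵍ (x ∷ p) w g≗h y = cong₂ _+_
  (cong (λ t → w 0 * (toℚ x * t)) (g≗h y)) (shiftPoly-congᵍ p (w ∘ suc) (λ z → g≗h (z - 1ℚ)) y)

shiftPoly-congʷ : ∀ p {w v} g → (∀ k → w k ≡ v k) → ∀ y → shiftPoly p w g y ≡ shiftPoly p v g y
shiftPoly-congʷ []      g w≗v y = refl
shiftPoly-congʷ (x ∷ p) g w≗v y = cong₂ _+_
  (cong (λ t → t * (toℚ x * g y)) (w≗v 0)) (shiftPoly-congʷ p (S g) (w≗v ∘ suc) y)

shiftPoly-0ᵍ : ∀ p w {g} → (∀ z → g z ≡ 0ℚ) → ∀ y → shiftPoly p w g y ≡ 0ℚ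
shiftPoly-0ᵍ []      w g≗0 y = refl
shiftPoly-0ᵍ (x ∷ p) w g≗0 y = cong₂ _+_
  (trans (cong (λ t → w 0 * (toℚ x * t)) (g≗0 y)) (trans (cong (w 0 *_) (*-zeroʳ (toℚ x))) (*-zeroʳ (w 0))))
  (shiftPoly-0ᵍ p (w ∘ suc) (λ z → g≗0 (z - 1ℚ)) y)

shiftPoly-0ʷ : ∀ p g y → shiftPoly p (λ _ → 0ℚ) g y ≡ 0ℚ
shiftPoly-0ʷ []      g y = refl
shiftPoly-0ʷ (x ∷ p) g y = cong₂ _+_ (*-zeroˡ (toℚ x * g y)) (shiftPoly-0ʷ p (S g) y)

shiftPoly-+ᵍ : ∀ p w g h y →
  shiftPoly p w (λ z → g z + h z) y ≡ shiftPoly p w g y + shiftPoly p w h y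
shiftPoly-+ᵍ []      w g h y = refl
shiftPoly-+ᵍ (x ∷ p) w g h y = trans
  (cong (λ t → w 0 * (toℚ x * (g y + h y)) + t) (shiftPoly-+ᵍ p (w ∘ suc) (S g) (S h) y))
  (solve 6 (λ W X G H A B → W :* (X :* (G :+ H)) :+ (A :+ B) := (W :* (X :* G) :+ A) :+ (W :* (X :* H) :+ B))
           refl (w 0) (toℚ x) (g y) (h y) (shiftPoly p (w ∘ suc) (S g) y) (shiftPoly p (w ∘ suc) (S h) y))

shiftPoly-+ʷ : ∀ p w v g y →
  shiftPoly p (λ k → w k + v k) g y ≡ shiftPoly p w g y + shiftPoly p v g y
shiftPoly-+ʷ []      w v g y = refl
shiftPoly-+ʷ (x ∷ p) w v g y = trans
  (cong (λ t → (w 0 + v 0) * (toℚ x * g y) + t) (shiftPoly-+ʷ p (w ∘ suc) (v ∘ suc) (S g) y))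
  (solve 5 (λ W V T A B → (W :+ V) :* T :+ (A :+ B) := (W :* T :+ A) :+ (V :* T :+ B))
           refl (w 0) (v 0) (toℚ x * g y) (shiftPoly p (w ∘ suc) (S g) y) (shiftPoly p (v ∘ suc) (S g) y))

shiftPoly-*ʷ : ∀ p c w g y → shiftPoly p (λ k → c * w k) g y ≡ c * shiftPoly p w g y
shiftPoly-*ʷ []      c w g y = sym (*-zeroʳ c)
shiftPoly-*ʷ (x ∷ p) c w g y = trans
  (cong (λ t → (c * w 0) * (toℚ x * g y) + t) (shiftPoly-*ʷ p c (w ∘ suc) (S g) y))
  (solve 4 (λ C W T A → (C :* W) :* T :+ C :* A := C :* (W :* T :+ A))
           refl c (w 0) (toℚ x * g y) (shiftPoly p (w ∘ suc) (S g) y))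

shiftPoly-∑ᵍ : ∀ p w {m} (h : Fin m → ℚ → ℚ) y →
  shiftPoly p w (λ z → ∑[ t < m ] h t z) y ≡ ∑[ t < m ] shiftPoly p w (h t) y
shiftPoly-∑ᵍ p w {zero}  h y = shiftPoly-0ᵍ p w (λ _ → refl) y
shiftPoly-∑ᵍ p w {suc m} h y = trans (shiftPoly-+ᵍ p w (h Fin.zero) (λ z → ∑[ t < m ] h (Fin.suc t) z) y)
  (cong (λ t → shiftPoly p w (h Fin.zero) y + t) (shiftPoly-∑ᵍ p w (h ∘ Fin.suc) y))

shiftPoly-∑ʷ : ∀ p {m} (w : Fin m → ℕ → ℚ) g y →
  shiftPoly p (λ k → ∑[ t < m ] w t k) g y ≡ ∑[ t < m ] shiftPoly p (w t) g y
shiftPoly-∑ʷ p {zero}  w g y = shiftPoly-0ʷ p g y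
shiftPoly-∑ʷ p {suc m} w g y = trans (shiftPoly-+ʷ p (w Fin.zero) (λ k → ∑[ t < m ] w (Fin.suc t) k) g y)
  (cong (λ t → shiftPoly p (w Fin.zero) g y + t) (shiftPoly-∑ʷ p (w ∘ Fin.suc) g y))

shiftPoly-S : ∀ p w g y → shiftPoly p w g (y - 1ℚ) ≡ shiftPoly p w (S g) y
shiftPoly-S []      w g y = refl
shiftPoly-S (x ∷ p) w g y = cong (λ t → w 0 * (toℚ x * g (y - 1ℚ)) + t) (shiftPoly-S p (w ∘ suc) (S g) y)

Sʲ-shiftPoly : ∀ j p w g y → Sʲ j (shiftPoly p w g) y ≡ shiftPoly p w (Sʲ j g) y
Sʲ-shiftPoly zero    p w g y = refl
Sʲ-shiftPoly (suc j) p w g y = trans (Sʲ-shiftPoly j p w g (y - 1ℚ)) (shiftPoly-S p w (Sʲ j g) y)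

geomPow : ℕ → ℕ → List ℕ
geomPow a n = powL (replicate a 1) n

length-addL : ∀ p q → length (addL p q) ≡ length p ℕ.⊔ length q
length-addL []      q       = refl
length-addL (x ∷ p) []      = refl
length-addL (x ∷ p) (y ∷ q) = cong suc (length-addL p q)

length-mulL : ∀ x p q {l} → length q ≡ suc l → length (mulL (x ∷ p) q) ≡ suc (length p ℕ.+ l)
length-mulL x []      (y ∷ q) refl =
  trans (length-addL (map (x ℕ.*_) (y ∷ q)) (0 ∷ [])) (cong suc (trans (ℕ.⊔-identityʳ _) (length-map _ q)))
length-mulL x (z ∷ p) (y ∷ q) refl = trans (length-addL (map (x ℕ.*_) (y ∷ q)) (0 ∷ mulL (z ∷ p) (y ∷ q)))
  (cong suc (trans (cong (length (map (x ℕ.*_) q) ℕ.⊔_) (length-mulL z p (y ∷ q) refl))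
                   (ℕ.m≤n⇒m⊔n≡n (ℕ.≤-trans (ℕ.≤-reflexive (length-map _ q)) (ℕ.m≤n+m (length q) (suc (length p)))))))

length-geomPow : ∀ b n → length (geomPow (suc b) n) ≡ suc (n ℕ.* b)
length-geomPow b zero    = refl
length-geomPow b (suc n) =
  trans (length-mulL 1 (replicate b 1) (geomPow (suc b) n) (length-geomPow b n))
        (cong (λ l → suc (l ℕ.+ n ℕ.* b)) (length-replicate b))

shiftPoly-addL : ∀ p q w g y → shiftPoly (addL p q) w g y ≡ shiftPoly p w g y + shiftPoly q w g y
shiftPoly-addL []      q       w g y = sym (+-identityˡ _)
shiftPoly-addL (x ∷ p) []      w g y = sym (+-identityʳ _)
shiftPoly-addL (x ∷ p) (z ∷ q) w g y = trans
  (cong₂ (λ u t → w 0 * (u * g y) + t) (toℚ-+ x z) (shiftPoly-addL p q (w ∘ suc) (S g) y))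
  (solve 6 (λ W X Z G A B → W :* ((X :+ Z) :* G) :+ (A :+ B) := (W :* (X :* G) :+ A) :+ (W :* (Z :* G) :+ B))
           refl (w 0) (toℚ x) (toℚ z) (g y) (shiftPoly p (w ∘ suc) (S g) y) (shiftPoly q (w ∘ suc) (S g) y))

shiftPoly-0∷ : ∀ p w g y → shiftPoly (0 ∷ p) w g y ≡ shiftPoly p (w ∘ suc) (S g) y
shiftPoly-0∷ p w g y = trans (cong (_+ shiftPoly p (w ∘ suc) (S g) y)
                                  (trans (cong (w 0 *_) (*-zeroˡ (g y))) (*-zeroʳ (w 0))))
                            (+-identityˡ _)

shiftPoly-replicate-mulL : ∀ a q w g y →
  shiftPoly (mulL (replicate a 1) q) w g y ≡ ∑[ m < a ] shiftPoly q (λ k → w (toℕ m ℕ.+ k)) (Sʲ (toℕ m) g) y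
shiftPoly-replicate-mulL zero    q w g y = refl
shiftPoly-replicate-mulL (suc a) q w g y = begin
  shiftPoly (addL (map (1 ℕ.*_) q) (0 ∷ mulL (replicate a 1) q)) w g y
    ≡⟨ shiftPoly-addL (map (1 ℕ.*_) q) _ w g y ⟩
  shiftPoly (map (1 ℕ.*_) q) w g y + shiftPoly (0 ∷ mulL (replicate a 1) q) w g y
    ≡⟨ cong₂ _+_ (cong (λ r → shiftPoly r w g y) (trans (map-cong ℕ.*-identityˡ q) (map-id q)))
                 (shiftPoly-0∷ (mulL (replicate a 1) q) w g y) ⟩
  shiftPoly q w g y + shiftPoly (mulL (replicate a 1) q) (w ∘ suc) (S g) y
    ≡⟨ cong (λ t → shiftPoly q w g y + t)
            (trans (shiftPoly-replicate-mulL a q (w ∘ suc) (S g) y)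
                   (sum-cong-≗ {a} (λ m → shiftPoly-congᵍ q _ (Sʲ-S (toℕ m) g) y))) ⟩
  ∑[ m < suc a ] shiftPoly q (λ k → w (toℕ m ℕ.+ k)) (Sʲ (toℕ m) g) y ∎

WindowNormalised : ℕ → (ℕ → ℚ) → Set
WindowNormalised a w = ∀ k → ∑[ m < a ] w (toℕ m ℕ.+ k) ≡ 1ℚ

WindowNormalised-shift : ∀ {a w} j → WindowNormalised a w → WindowNormalised a (λ k → w (j ℕ.+ k))
WindowNormalised-shift {a} {w} j normalised k =
  trans (sum-cong-≗ {a} (λ m → cong w (x∙yz≈y∙xz j (toℕ m) k))) (normalised (j ℕ.+ k))

shiftPoly-decompose : ∀ a n {w} → WindowNormalised a w → ∀ g y →
  shiftPoly (geomPow a n) (λ _ → 1ℚ) g y ≡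
  shiftPoly (geomPow a (suc n)) w g y
    + ∑[ m < a ] ∑[ t < toℕ m ] shiftPoly (geomPow a n) (λ k → w (toℕ m ℕ.+ k)) (Sʲ (toℕ t) (Δ g)) y
shiftPoly-decompose a n {w} normalised g y = begin
  shiftPoly Q (λ _ → 1ℚ) g y
    ≡⟨ shiftPoly-congʷ Q g (λ k → sym (normalised k)) y ⟩
  shiftPoly Q (λ k → ∑[ m < a ] wₘ m k) g y
    ≡⟨ shiftPoly-∑ʷ Q wₘ g y ⟩
  ∑[ m < a ] shiftPoly Q (wₘ m) g y
    ≡⟨ sum-cong-≗ {a} telescope ⟩
  ∑[ m < a ] (shiftPoly Q (wₘ m) (Sʲ (toℕ m) g) y + ∑[ t < toℕ m ] shiftPoly Q (wₘ m) (Sʲ (toℕ t) (Δ g)) y)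
    ≡⟨ ∑-distrib-+ (λ m → shiftPoly Q (wₘ m) (Sʲ (toℕ m) g) y) _ ⟩
  ∑[ m < a ] shiftPoly Q (wₘ m) (Sʲ (toℕ m) g) y + R
    ≡⟨ cong (_+ R) (shiftPoly-replicate-mulL a Q w g y) ⟨
  shiftPoly (geomPow a (suc n)) w g y + R ∎
  where
  Q = geomPow a n
  wₘ : Fin a → ℕ → ℚ
  wₘ m k = w (toℕ m ℕ.+ k)
  R = ∑[ m < a ] ∑[ t < toℕ m ] shiftPoly Q (wₘ m) (Sʲ (toℕ t) (Δ g)) y
  telescope : ∀ m → shiftPoly Q (wₘ m) g y ≡
    shiftPoly Q (wₘ m) (Sʲ (toℕ m) g) y + ∑[ t < toℕ m ] shiftPoly Q (wₘ m) (Sʲ (toℕ t) (Δ g)) y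
  telescope m = trans (shiftPoly-congᵍ Q (wₘ m) (Sʲ-telescope (toℕ m) g) y)
    (trans (shiftPoly-+ᵍ Q (wₘ m) (Sʲ (toℕ m) g) _ y)
           (cong (λ t → shiftPoly Q (wₘ m) (Sʲ (toℕ m) g) y + t)
                 (shiftPoly-∑ᵍ Q (wₘ m) {toℕ m} (λ t → Sʲ (toℕ t) (Δ g)) y)))

shiftPoly-weight-independent : ∀ a n {g} → ΔVanishes n g → ∀ {w v : ℕ → ℚ} →
  WindowNormalised a w → WindowNormalised a v → ∀ y → shiftPoly (geomPow a n) w g y ≡ shiftPoly (geomPow a n) v g y
shiftPoly-weight-independent a zero    vanish {w} {v} _ _ y =
  trans (shiftPoly-0ᵍ (geomPow a 0) w vanish y) (sym (shiftPoly-0ᵍ (geomPow a 0) v vanish y))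
shiftPoly-weight-independent a (suc n) {g} vanish {w} {v} w-normalised v-normalised y =
  ∙-cancelʳ (R w) _ _ (begin
    shiftPoly (geomPow a (suc n)) w g y + R w  ≡⟨ shiftPoly-decompose a n w-normalised g y ⟨
    shiftPoly (geomPow a n) (λ _ → 1ℚ) g y     ≡⟨ shiftPoly-decompose a n v-normalised g y ⟩
    shiftPoly (geomPow a (suc n)) v g y + R v  ≡⟨ cong (λ t → shiftPoly (geomPow a (suc n)) v g y + t) R-independent ⟨
    shiftPoly (geomPow a (suc n)) v g y + R w  ∎)
  where
  R : (ℕ → ℚ) → ℚ
  R u = ∑[ m < a ] ∑[ t < toℕ m ] shiftPoly (geomPow a n) (λ k → u (toℕ m ℕ.+ k)) (Sʲ (toℕ t) (Δ g)) y
  R-independent : R w ≡ R v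
  R-independent = sum-cong-≗ {a} (λ m → sum-cong-≗ {toℕ m} (λ t →
    shiftPoly-weight-independent a n (ΔVanishes-Sʲ n (toℕ t) vanish)
      (WindowNormalised-shift {a} {w} (toℕ m) w-normalised)
      (WindowNormalised-shift {a} {v} (toℕ m) v-normalised) y))

classWeight : (a : ℕ) .{{_ : NonZero a}} → ℕ → ℕ → ℚ
classWeight a i k = indicator (k % a ≡ᵇ i)

classWeight-windowNormalised : ∀ a .{{_ : NonZero a}} {i} → i < a → WindowNormalised a (classWeight a i)
classWeight-windowNormalised a {i} i<a k = begin
  ∑[ m < a ] indicator ((toℕ m ℕ.+ k) % a ≡ᵇ i)
    ≡⟨ ∑-periodic (classWeight a i) (λ x → cong (λ r → indicator (r ≡ᵇ i)) ([m+n]%n≡m%n x a)) k ⟩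
  ∑[ m < a ] indicator (toℕ m % a ≡ᵇ i)
    ≡⟨ sum-cong-≗ {a} (λ m → cong (λ r → indicator (r ≡ᵇ i)) (m<n⇒m%n≡m (toℕ<n m))) ⟩
  ∑[ m < a ] indicator (toℕ m ≡ᵇ i)
    ≡⟨ ∑-indicator-≡ᵇ i i<a ⟩
  1ℚ ∎

uniform-windowNormalised : ∀ a .{{_ : NonZero a}} → WindowNormalised a (λ _ → (+ 1) / a)
uniform-windowNormalised (suc b) k = trans (∑-const (suc b) ((+ 1) / suc b)) (toℚ-*-inverse b)

Σᵢ≡shiftPoly : ∀ b n i g y → Σᵢ (suc b) n i g y ≡ shiftPoly (geomPow (suc b) n) (classWeight (suc b) i) g y
Σᵢ≡shiftPoly b n i g y = begin
  Σᵢ (suc b) n i g y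
    ≡⟨ foldr-+-upTo (suc (n ℕ.* b)) summand ⟩
  ∑[ k < suc (n ℕ.* b) ] summand (toℕ k)
    ≡⟨ sum-cong-≗ {suc (n ℕ.* b)} (λ k → if-then-else-0 (toℕ k % suc b ≡ᵇ i) (term (toℕ k))) ⟩
  ∑[ k < suc (n ℕ.* b) ] (classWeight (suc b) i (toℕ k) * term (toℕ k))
    ≡⟨ cong (λ N → ∑[ k < N ] (classWeight (suc b) i (toℕ k) * term (toℕ k))) (length-geomPow b n) ⟨
  ∑[ k < length (geomPow (suc b) n) ] (classWeight (suc b) i (toℕ k) * term (toℕ k))
    ≡⟨ shiftPoly-∑ (geomPow (suc b) n) (classWeight (suc b) i) g y ⟩
  shiftPoly (geomPow (suc b) n) (classWeight (suc b) i) g y ∎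
  where
  term : ℕ → ℚ
  term k = toℚ (c (suc b) n k) * g (y - toℚ k)
  summand : ℕ → ℚ
  summand k = if k % suc b ≡ᵇ i then term k else 0ℚ

geomSⁿ≡shiftPoly : ∀ a n g y → geomSⁿ a n g y ≡ shiftPoly (geomPow a n) (λ _ → 1ℚ) g y
geomSⁿ≡shiftPoly a zero    g y = solve 1 (λ G → G := con 1ℚ :* (con 1ℚ :* G) :+ con 0ℚ) refl (g y)
geomSⁿ≡shiftPoly a (suc n) g y = begin
  geomS a (geomSⁿ a n g) y
    ≡⟨ foldr-+-upTo a (λ j → Sʲ j (geomSⁿ a n g) y) ⟩
  ∑[ j < a ] Sʲ (toℕ j) (geomSⁿ a n g) y
    ≡⟨ sum-cong-≗ {a} (λ j → trans (Sʲ-cong (toℕ j) (geomSⁿ≡shiftPoly a n g) y)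
                                   (Sʲ-shiftPoly (toℕ j) (geomPow a n) (λ _ → 1ℚ) g y)) ⟩
  ∑[ j < a ] shiftPoly (geomPow a n) (λ _ → 1ℚ) (Sʲ (toℕ j) g) y
    ≡⟨ shiftPoly-replicate-mulL a (geomPow a n) (λ _ → 1ℚ) g y ⟨
  shiftPoly (geomPow a (suc n)) (λ _ → 1ℚ) g y ∎

lemma2p2 : (a n : ℕ) → .{{_ : NonZero a}} → .{{_ : NonZero n}}
           → (f : Vec ℚ n) → (i : ℕ) → i < a
           → ((j : ℕ) → j < a → (y : ℚ) → Σᵢ a n i (eval f) y ≡ Σᵢ a n j (eval f) y)
             × ((y : ℚ) → Σᵢ a n i (eval f) y ≡ ((+ 1) / a) * geomSⁿ a n (eval f) y)
lemma2p2 (suc b) n f i i<a = independent-of-class , average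
  where
  a = suc b
  Q = geomPow a n
  g = eval f
  weight-independent : ∀ {w v} → WindowNormalised a w → WindowNormalised a v →
                       ∀ y → shiftPoly Q w g y ≡ shiftPoly Q v g y
  weight-independent = shiftPoly-weight-independent a n (eval-ΔVanishes n f)
  independent-of-class : ∀ j → j < a → ∀ y → Σᵢ a n i g y ≡ Σᵢ a n j g y
  independent-of-class j j<a y = begin
    Σᵢ a n i g y                      ≡⟨ Σᵢ≡shiftPoly b n i g y ⟩
    shiftPoly Q (classWeight a i) g y ≡⟨ weight-independent (classWeight-windowNormalised a i<a)
                                                             (classWeight-windowNormalised a j<a) y ⟩
    shiftPoly Q (classWeight a j) g y ≡⟨ Σᵢ≡shiftPoly b n j g y ⟨
    Σᵢ a n j g y                      ∎
  average : ∀ y → Σᵢ a n i g y ≡ ((+ 1) / a) * geomSⁿ a n g y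
  average y = begin
    Σᵢ a n i g y                                 ≡⟨ Σᵢ≡shiftPoly b n i g y ⟩
    shiftPoly Q (classWeight a i) g y            ≡⟨ weight-independent (classWeight-windowNormalised a i<a)
                                                                        (uniform-windowNormalised a) y ⟩
    shiftPoly Q (λ _ → (+ 1) / a) g y            ≡⟨ shiftPoly-congʷ Q g (λ _ → *-identityʳ _) y ⟨
    shiftPoly Q (λ _ → (+ 1) / a * 1ℚ) g y       ≡⟨ shiftPoly-*ʷ Q ((+ 1) / a) (λ _ → 1ℚ) g y ⟩
    ((+ 1) / a) * shiftPoly Q (λ _ → 1ℚ) g y     ≡⟨ cong (((+ 1) / a) *_) (geomSⁿ≡shiftPoly a n g y) ⟨
    ((+ 1) / a) * geomSⁿ a n g y                 ∎
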